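{- Let $n\ge 1$ and $d\ge 5$, and let $\mathcal A_1,\dots,\mathcal A_d\subset 2^{[n]}$ be pairwise cross-IU families with $|\mathcal A_1|\ge|\mathcal A_2|\ge\dots\ge|\mathcal A_d|$. Then $|\mathcal A_1|+\dots+|\mathcal A_d|\le d\cdot 2^{n-2}$, and the inequality is strict unless $\mathcal A_1=\dots=\mathcal A_d$.
   Context: Families $\mathcal A,\mathcal B\subset 2^{[n]}$ are cross-IU if for all $A\in\mathcal A$ and $B\in\mathcal B$ we have both $A\cap B\ne\emptyset$ and $A\cup B\ne[n]$. Pairwise cross-IU means $\mathcal A_i,\mathcal A_j$ are cross-IU for all $i\ne j$. -}

module Defs where

open import Data.Nat using (ℕ; zero; suc; _+_)
open import Data.Bool using (Bool; true; false)
open import Data.Vec using (Vec; []; _∷_)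
open import Data.List using (List; []; _∷_; map; _++_; length; filterᵇ)
open import Data.Fin using (Fin)
open import Data.Fin.Subset using (Subset; _∩_; _∪_; ⊤; Nonempty)
open import Relation.Binary.PropositionalEquality using (_≡_)
open import Relation.Nullary using (¬_)

allSubsets : (n : ℕ) → List (Subset n)
allSubsets zero = [] ∷ []
allSubsets (suc n) = map (false ∷_) (allSubsets n) ++ map (true ∷_) (allSubsets n)

Family : ℕ → Set
Family n = Subset n → Bool

card : {n : ℕ} → Family n → ℕ
card {n} 𝒜 = length (filterᵇ 𝒜 (allSubsets n))

CrossIU : {n : ℕ} → Family n → Family n → Set
CrossIU 𝒜 ℬ = ∀ A B → 𝒜 A ≡ true → ℬ B ≡ true → Nonempty (A ∩ B) × ¬ (A ∪ B ≡ ⊤)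
  where open import Data.Product using (_×_)

SameFamily : {n : ℕ} → Family n → Family n → Set
SameFamily 𝒜 ℬ = ∀ S → 𝒜 S ≡ ℬ S

sumFin : (d : ℕ) → (Fin d → ℕ) → ℕ
sumFin zero f = 0
sumFin (suc d) f = f Fin.zero + sumFin d (λ i → f (Fin.suc i))

{-# OPTIONS --safe #-}
-- For cross-IU families A and B, both A, B and their complement families A ∘ ∁, B ∘ ∁ are
-- cross-intersecting, and so are their up-closures; pairing S with ∁ S gives
-- |↑A| + |↑B| ≤ 2ⁿ and |↑(A ∘ ∁)| + |↑(B ∘ ∁)| ≤ 2ⁿ.  The Harris–Kleitman inequality
-- 2ⁿ |A| ≤ |↑A| |↑(A ∘ ∁)| and AM–GM then give 16 |A| |B| ≤ 4ⁿ.  Applied to the two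
-- largest families, with |A₁| + |A₂| ≤ 2ⁿ and |Aᵢ| ≤ |A₂| for i ≥ 2, a calculation that needs
-- d ≥ 5 bounds the sum, with equality only if every family has 2ⁿ⁻² members.  In that case,
-- for i ≠ j pick a third k: Aⱼ ∪ Aᵢ is still cross-IU with Aₖ, so the product bound forbids it
-- to be larger than Aⱼ, i.e. Aᵢ ⊆ Aⱼ.
module Submission where

open import Defs
open import Data.Nat using (ℕ; zero; suc; _+_; _*_; _^_; _≤_; _<_; z≤n; s≤s; z<s; s<s; NonZero; _≤?_)
open import Data.Nat.Properties
open import Data.Nat.Tactic.RingSolver using (solve-∀)
open import Algebra.Properties.CommutativeSemigroup *-commutativeSemigroup using (x∙yz≈y∙xz)
open import Data.Bool using (Bool; true; false; _∧_; _∨_; if_then_else_)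
open import Data.Bool.Properties using (∨-zeroʳ; not-involutive)
open import Data.Vec using ([]; _∷_; here; there)
open import Data.List using (List; []; _∷_; map; _++_; length; filterᵇ)
open import Data.List.Properties using (length-++; filter-++)
open import Data.Fin as Fin using (Fin; punchIn; punchOut) renaming (_<_ to _<ᶠ_)
open import Data.Fin.Patterns using (0F; 1F)
open import Data.Fin.Properties using (punchInᵢ≢i; punchIn-injective; punchIn-punchOut)
open import Data.Fin.Subset using (Subset; _∈_; _∩_; _∪_; ∁; ⊤; Nonempty; _⊆_)
open import Data.Fin.Subset.Properties
  using (⊆-refl; ⊆-trans; drop-∷-⊆; s⊆s; out⊆; ∉⊥; ∩-inverseʳ; x∈p∩q⁺; x∈p∩q⁻)
open import Data.Sum as Sum using (_⊎_; inj₁; inj₂)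
open import Data.Product as Σ using (_×_; _,_; proj₁; proj₂; ∃-syntax)
open import Data.Empty using (⊥; ⊥-elim)
open import Function using (_∘_)
open import Relation.Binary.PropositionalEquality
open import Relation.Nullary using (¬_; contradiction; yes; no)

private variable
  n : ℕ

count : Family n → ℕ
count {zero} A = if A [] then 1 else 0
count {suc n} A = count (A ∘ (false ∷_)) + count (A ∘ (true ∷_))

length-filterᵇ-map : {X Y : Set} (p : Y → Bool) (f : X → Y) (xs : List X) →
  length (filterᵇ p (map f xs)) ≡ length (filterᵇ (p ∘ f) xs)
length-filterᵇ-map p f [] = refl
length-filterᵇ-map p f (x ∷ xs) with p (f x)
... | true = cong suc (length-filterᵇ-map p f xs)
... | false = length-filterᵇ-map p f xs

card≡count : (A : Family n) → card A ≡ count A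
card≡count {zero} A with A []
... | true = refl
... | false = refl
card≡count {suc n} A = begin
  length (filterᵇ A (map (false ∷_) L ++ map (true ∷_) L))
    ≡⟨ cong length (filter-++ _ (map (false ∷_) L) (map (true ∷_) L)) ⟩
  length (filterᵇ A (map (false ∷_) L) ++ filterᵇ A (map (true ∷_) L))
    ≡⟨ length-++ (filterᵇ A (map (false ∷_) L)) ⟩
  length (filterᵇ A (map (false ∷_) L)) + length (filterᵇ A (map (true ∷_) L))
    ≡⟨ cong₂ _+_ (trans (length-filterᵇ-map A (false ∷_) L) (card≡count (A ∘ (false ∷_))))
                 (trans (length-filterᵇ-map A (true ∷_) L) (card≡count (A ∘ (true ∷_)))) ⟩
  count A ∎
  where
  open ≡-Reasoning
  L = allSubsets n

infix 4 _⊆ᶠ_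
infixr 6 _∪ᶠ_

_⊆ᶠ_ : Family n → Family n → Set
A ⊆ᶠ B = ∀ S → A S ≡ true → B S ≡ true

_∪ᶠ_ : Family n → Family n → Family n
(A ∪ᶠ B) S = A S ∨ B S

⊆ᶠ-antisym : {A B : Family n} → A ⊆ᶠ B → B ⊆ᶠ A → SameFamily A B
⊆ᶠ-antisym {A = A} {B} A⊆B B⊆A S with A S in AS | B S in BS
... | true | true = refl
... | false | false = refl
... | true | false = contradiction (trans (sym (A⊆B S AS)) BS) λ ()
... | false | true = contradiction (trans (sym (B⊆A S BS)) AS) λ ()

count-mono : {A B : Family n} → A ⊆ᶠ B → count A ≤ count B
count-mono {zero} {A} {B} A⊆B with A [] in AS | B [] in BS
... | false | _ = z≤n
... | true | true = ≤-refl
... | true | false = contradiction (trans (sym (A⊆B [] AS)) BS) λ ()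
count-mono {suc n} A⊆B = +-mono-≤ (count-mono (A⊆B ∘ (false ∷_))) (count-mono (A⊆B ∘ (true ∷_)))

count-mono-< : {A B : Family n} → A ⊆ᶠ B → (S : Subset n) → A S ≡ false → B S ≡ true →
  count A < count B
count-mono-< A⊆B [] AS BS rewrite AS | BS = ≤-refl
count-mono-< A⊆B (false ∷ S) AS BS =
  +-mono-<-≤ (count-mono-< (A⊆B ∘ (false ∷_)) S AS BS) (count-mono (A⊆B ∘ (true ∷_)))
count-mono-< A⊆B (true ∷ S) AS BS =
  +-mono-≤-< (count-mono (A⊆B ∘ (false ∷_))) (count-mono-< (A⊆B ∘ (true ∷_)) S AS BS)

complement-disjoint⇒count+count≤2^n : {A B : Family n} →
  (∀ S → A S ≡ true → B (∁ S) ≡ true → ⊥) → count A + count B ≤ 2 ^ n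
complement-disjoint⇒count+count≤2^n {zero} {A} {B} disjoint with A [] in AS | B [] in BS
... | true | true = ⊥-elim (disjoint [] AS BS)
... | true | false = ≤-refl
... | false | true = ≤-refl
... | false | false = z≤n
complement-disjoint⇒count+count≤2^n {suc n} {A} {B} disjoint = begin
  (a₀ + a₁) + (b₀ + b₁) ≡⟨ interchange a₀ a₁ b₀ b₁ ⟩
  (a₀ + b₁) + (a₁ + b₀) ≤⟨ +-mono-≤ (complement-disjoint⇒count+count≤2^n (disjoint ∘ (false ∷_)))
                                    (complement-disjoint⇒count+count≤2^n (disjoint ∘ (true ∷_))) ⟩
  2 ^ n + 2 ^ n         ≡⟨ cong (2 ^ n +_) (sym (+-identityʳ (2 ^ n))) ⟩
  2 ^ suc n             ∎
  where
  open ≤-Reasoning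
  a₀ = count (A ∘ (false ∷_))
  a₁ = count (A ∘ (true ∷_))
  b₀ = count (B ∘ (false ∷_))
  b₁ = count (B ∘ (true ∷_))
  interchange : ∀ w x y z → (w + x) + (y + z) ≡ (w + z) + (x + y)
  interchange = solve-∀

∁-involutive : (S : Subset n) → ∁ (∁ S) ≡ S
∁-involutive [] = refl
∁-involutive (b ∷ S) = cong₂ _∷_ (not-involutive b) (∁-involutive S)

Nonempty-∩-mono : {S S′ T T′ : Subset n} → S ⊆ S′ → T ⊆ T′ → Nonempty (S ∩ T) → Nonempty (S′ ∩ T′)
Nonempty-∩-mono {S = S} {T = T} S⊆S′ T⊆T′ (x , x∈S∩T) =
  x , x∈p∩q⁺ (Σ.map S⊆S′ T⊆T′ (x∈p∩q⁻ S T x∈S∩T))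

∁∪∁≢⊤⇒Nonempty-∩ : (S T : Subset n) → ¬ (∁ S ∪ ∁ T ≡ ⊤) → Nonempty (S ∩ T)
∁∪∁≢⊤⇒Nonempty-∩ [] [] ∁S∪∁T≢⊤ = contradiction refl ∁S∪∁T≢⊤
∁∪∁≢⊤⇒Nonempty-∩ (true ∷ S) (true ∷ T) _ = 0F , here
∁∪∁≢⊤⇒Nonempty-∩ (true ∷ S) (false ∷ T) ∁S∪∁T≢⊤ =
  Σ.map Fin.suc there (∁∪∁≢⊤⇒Nonempty-∩ S T (∁S∪∁T≢⊤ ∘ cong (true ∷_)))
∁∪∁≢⊤⇒Nonempty-∩ (false ∷ S) (b ∷ T) ∁S∪∁T≢⊤ =
  Σ.map Fin.suc there (∁∪∁≢⊤⇒Nonempty-∩ S T (∁S∪∁T≢⊤ ∘ cong (true ∷_)))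

CrossIntersecting : Family n → Family n → Set
CrossIntersecting A B = ∀ S T → A S ≡ true → B T ≡ true → Nonempty (S ∩ T)

CrossIntersecting⇒count+count≤2^n : {A B : Family n} → CrossIntersecting A B →
  count A + count B ≤ 2 ^ n
CrossIntersecting⇒count+count≤2^n cross = complement-disjoint⇒count+count≤2^n λ S AS B∁S →
  let x , x∈S∩∁S = cross S (∁ S) AS B∁S in ∉⊥ (subst (x ∈_) (∩-inverseʳ S) x∈S∩∁S)

IsUpset : Family n → Set
IsUpset U = ∀ {S T} → S ⊆ T → U S ≡ true → U T ≡ true

↑ : Family n → Family n
↑ {zero} A = A
↑ {suc n} A (false ∷ T) = ↑ (A ∘ (false ∷_)) T
↑ {suc n} A (true ∷ T) = ↑ (A ∘ (false ∷_)) T ∨ ↑ (A ∘ (true ∷_)) T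

↑-complete : (A : Family n) {S T : Subset n} → S ⊆ T → A S ≡ true → ↑ A T ≡ true
↑-complete {zero} A {[]} {[]} _ AS = AS
↑-complete {suc n} A {false ∷ S} {false ∷ T} S⊆T AS =
  ↑-complete (A ∘ (false ∷_)) (drop-∷-⊆ S⊆T) AS
↑-complete {suc n} A {false ∷ S} {true ∷ T} S⊆T AS =
  cong (_∨ ↑ (A ∘ (true ∷_)) T) (↑-complete (A ∘ (false ∷_)) (drop-∷-⊆ S⊆T) AS)
↑-complete {suc n} A {true ∷ S} {true ∷ T} S⊆T AS =
  trans (cong (↑ (A ∘ (false ∷_)) T ∨_) (↑-complete (A ∘ (true ∷_)) (drop-∷-⊆ S⊆T) AS))
        (∨-zeroʳ _)
↑-complete {suc n} A {true ∷ S} {false ∷ T} S⊆T AS = contradiction (S⊆T here) λ ()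

↑-sound : (A : Family n) {T : Subset n} → ↑ A T ≡ true → ∃[ S ] S ⊆ T × A S ≡ true
↑-sound {zero} A {[]} AT = [] , ⊆-refl , AT
↑-sound {suc n} A {false ∷ T} ↑AT =
  let S , S⊆T , AS = ↑-sound (A ∘ (false ∷_)) ↑AT in false ∷ S , s⊆s S⊆T , AS
↑-sound {suc n} A {true ∷ T} ↑AT with ↑ (A ∘ (false ∷_)) T in ↑A₀T
... | true = let S , S⊆T , AS = ↑-sound (A ∘ (false ∷_)) ↑A₀T in false ∷ S , out⊆ S⊆T , AS
... | false = let S , S⊆T , AS = ↑-sound (A ∘ (true ∷_)) ↑AT in true ∷ S , s⊆s S⊆T , AS

↑-isUpset : (A : Family n) → IsUpset (↑ A)
↑-isUpset A S⊆T ↑AS = let R , R⊆S , AR = ↑-sound A ↑AS in ↑-complete A (⊆-trans R⊆S S⊆T) AR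

⊆ᶠ-↑ : (A : Family n) → A ⊆ᶠ ↑ A
⊆ᶠ-↑ A S = ↑-complete A ⊆-refl

↑-CrossIntersecting : {A B : Family n} → CrossIntersecting A B → CrossIntersecting (↑ A) (↑ B)
↑-CrossIntersecting {A = A} {B} cross S T ↑AS ↑BT =
  let S′ , S′⊆S , AS′ = ↑-sound A ↑AS
      T′ , T′⊆T , BT′ = ↑-sound B ↑BT
  in Nonempty-∩-mono S′⊆S T′⊆T (cross S′ T′ AS′ BT′)

rearrangement : ∀ {a b c d} → a ≤ b → c ≤ d → 2 * (a * d + b * c) ≤ (a + b) * (c + d)
rearrangement {a} {c = c} a≤b c≤d with m≤n⇒∃[o]m+o≡n a≤b | m≤n⇒∃[o]m+o≡n c≤d
... | p , refl | q , refl = begin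
  2 * (a * (c + q) + (a + p) * c)                  ≡⟨ lhs a c p q ⟩
  4 * (a * c) + 2 * (a * q) + 2 * (p * c)          ≤⟨ m≤m+n _ (p * q) ⟩
  4 * (a * c) + 2 * (a * q) + 2 * (p * c) + p * q  ≡⟨ rhs a c p q ⟩
  (a + (a + p)) * (c + (c + q))                    ∎
  where
  open ≤-Reasoning
  lhs : ∀ a c p q → 2 * (a * (c + q) + (a + p) * c) ≡ 4 * (a * c) + 2 * (a * q) + 2 * (p * c)
  lhs = solve-∀
  rhs : ∀ a c p q → 4 * (a * c) + 2 * (a * q) + 2 * (p * c) + p * q ≡ (a + (a + p)) * (c + (c + q))
  rhs = solve-∀

am-gm : ∀ a b → 4 * (a * b) ≤ (a + b) * (a + b)
am-gm a b with ≤-total a b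
... | inj₁ a≤b = subst (_≤ (a + b) * (a + b)) (double a b) (rearrangement a≤b a≤b)
  where
  double : ∀ a b → 2 * (a * b + b * a) ≡ 4 * (a * b)
  double = solve-∀
... | inj₂ b≤a = subst₂ _≤_ (double b a) (cong (λ c → c * c) (+-comm b a)) (rearrangement b≤a b≤a)
  where
  double : ∀ b a → 2 * (b * a + a * b) ≡ 4 * (a * b)
  double = solve-∀

-- Harris–Kleitman for the up-set U and the down-set {S | ∁ S ∈ V}.
harris-kleitman : {U V : Family n} → IsUpset U → IsUpset V →
  2 ^ n * count (λ S → U S ∧ V (∁ S)) ≤ count U * count V
harris-kleitman {zero} {U} {V} _ _ with U [] | V []
... | true | true = ≤-refl
... | true | false = z≤n
... | false | _ = z≤n
harris-kleitman {suc n} {U} {V} U↑ V↑ = begin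
  2 * 2 ^ n * (x₀ + x₁)         ≡⟨ distrib (2 ^ n) x₀ x₁ ⟩
  2 * (2 ^ n * x₀ + 2 ^ n * x₁) ≤⟨ *-monoʳ-≤ 2 (+-mono-≤ IH₀ IH₁) ⟩
  2 * (u₀ * v₁ + u₁ * v₀)       ≤⟨ rearrangement (count-mono (step U↑)) (count-mono (step V↑)) ⟩
  (u₀ + u₁) * (v₀ + v₁)         ∎
  where
  open ≤-Reasoning
  slice : {W : Family (suc n)} (b : Bool) → IsUpset W → IsUpset (W ∘ (b ∷_))
  slice _ W↑ S⊆T = W↑ (s⊆s S⊆T)
  step : {W : Family (suc n)} → IsUpset W → W ∘ (false ∷_) ⊆ᶠ W ∘ (true ∷_)
  step W↑ S = W↑ (out⊆ ⊆-refl)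
  x₀ = count (λ S → U (false ∷ S) ∧ V (true ∷ ∁ S))
  x₁ = count (λ S → U (true ∷ S) ∧ V (false ∷ ∁ S))
  u₀ = count (U ∘ (false ∷_))
  u₁ = count (U ∘ (true ∷_))
  v₀ = count (V ∘ (false ∷_))
  v₁ = count (V ∘ (true ∷_))
  IH₀ : 2 ^ n * x₀ ≤ u₀ * v₁
  IH₀ = harris-kleitman (slice false U↑) (slice true V↑)
  IH₁ : 2 ^ n * x₁ ≤ u₁ * v₀
  IH₁ = harris-kleitman (slice true U↑) (slice false V↑)
  distrib : ∀ N x y → 2 * N * (x + y) ≡ 2 * (N * x + N * y)
  distrib = solve-∀

2^n*count≤count↑*count↑∁ : (A : Family n) → 2 ^ n * count A ≤ count (↑ A) * count (↑ (A ∘ ∁))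
2^n*count≤count↑*count↑∁ {n} A =
  ≤-trans (*-monoʳ-≤ (2 ^ n) (count-mono A⊆↑A∩∁↑A∘∁)) (harris-kleitman (↑-isUpset A) (↑-isUpset (A ∘ ∁)))
  where
  A⊆↑A∩∁↑A∘∁ : A ⊆ᶠ (λ S → ↑ A S ∧ ↑ (A ∘ ∁) (∁ S))
  A⊆↑A∩∁↑A∘∁ S AS =
    cong₂ _∧_ (⊆ᶠ-↑ A S AS) (⊆ᶠ-↑ (A ∘ ∁) (∁ S) (trans (cong A (∁-involutive S)) AS))

CrossIU⇒CrossIntersecting : {A B : Family n} → CrossIU A B → CrossIntersecting A B
CrossIU⇒CrossIntersecting cross S T AS BT = proj₁ (cross S T AS BT)

CrossIU⇒CrossIntersecting-∁ : {A B : Family n} → CrossIU A B → CrossIntersecting (A ∘ ∁) (B ∘ ∁)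
CrossIU⇒CrossIntersecting-∁ cross S T A∁S B∁T =
  ∁∪∁≢⊤⇒Nonempty-∩ S T (proj₂ (cross (∁ S) (∁ T) A∁S B∁T))

CrossIU⇒card+card≤2^n : {A B : Family n} → CrossIU A B → card A + card B ≤ 2 ^ n
CrossIU⇒card+card≤2^n {n} {A} {B} cross =
  subst (_≤ 2 ^ n) (sym (cong₂ _+_ (card≡count A) (card≡count B)))
        (CrossIntersecting⇒count+count≤2^n (CrossIU⇒CrossIntersecting cross))

CrossIU⇒4card*4card≤4^n : {A B : Family n} → CrossIU A B →
  4 * card A * (4 * card B) ≤ 2 ^ n * 2 ^ n
CrossIU⇒4card*4card≤4^n {n} {A} {B} cross rewrite card≡count A | card≡count B =
  *-cancelˡ-≤ (N * N) {{m*n≢0 N N}} (begin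
    N * N * (4 * count A * (4 * count B))  ≡⟨ regroup N (count A) (count B) ⟩
    16 * ((N * count A) * (N * count B))   ≤⟨ *-monoʳ-≤ 16 (*-mono-≤ (2^n*count≤count↑*count↑∁ A)
                                                                    (2^n*count≤count↑*count↑∁ B)) ⟩
    16 * ((a * a′) * (b * b′))             ≡⟨ pair a a′ b b′ ⟩
    (4 * (a * b)) * (4 * (a′ * b′))        ≤⟨ *-mono-≤ (bounded-am-gm a b a+b≤N) (bounded-am-gm a′ b′ a′+b′≤N) ⟩
    N * N * (N * N)                        ∎)
  where
  open ≤-Reasoning
  instance _ = m^n≢0 2 n
  N = 2 ^ n
  a = count (↑ A)
  a′ = count (↑ (A ∘ ∁))
  b = count (↑ B)
  b′ = count (↑ (B ∘ ∁))
  a+b≤N : a + b ≤ N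
  a+b≤N = CrossIntersecting⇒count+count≤2^n (↑-CrossIntersecting (CrossIU⇒CrossIntersecting cross))
  a′+b′≤N : a′ + b′ ≤ N
  a′+b′≤N = CrossIntersecting⇒count+count≤2^n (↑-CrossIntersecting (CrossIU⇒CrossIntersecting-∁ cross))
  bounded-am-gm : ∀ x y → x + y ≤ N → 4 * (x * y) ≤ N * N
  bounded-am-gm x y x+y≤N = ≤-trans (am-gm x y) (*-mono-≤ x+y≤N x+y≤N)
  regroup : ∀ N x y → N * N * (4 * x * (4 * y)) ≡ 16 * ((N * x) * (N * y))
  regroup = solve-∀
  pair : ∀ a a′ b b′ → 16 * ((a * a′) * (b * b′)) ≡ (4 * (a * b)) * (4 * (a′ * b′))
  pair = solve-∀

∪ᶠ-CrossIU : {A B C : Family n} → CrossIU A C → CrossIU B C → CrossIU (A ∪ᶠ B) C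
∪ᶠ-CrossIU {A = A} AC BC S T A∪BS CT with A S in AS
... | true = AC S T AS CT
... | false = BC S T A∪BS CT

quarter-sized-⊆ᶠ : {A B C : Family n} → CrossIU A C → CrossIU B C →
  4 * card B ≡ 2 ^ n → 4 * card C ≡ 2 ^ n → A ⊆ᶠ B
quarter-sized-⊆ᶠ {n} {A} {B} {C} AC BC 4|B|≡N 4|C|≡N S AS with B S in BS
... | true = refl
... | false = ⊥-elim (<⇒≱ |B|<|B∪A| |B∪A|≤|B|)
  where
  instance _ = m^n≢0 2 n
  |B|<|B∪A| : card B < card (B ∪ᶠ A)
  |B|<|B∪A| = subst₂ _<_ (sym (card≡count B)) (sym (card≡count (B ∪ᶠ A)))
    (count-mono-< (λ T BT → cong (_∨ A T) BT) S BS (trans (cong (B S ∨_) AS) (∨-zeroʳ _)))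
  |B∪A|≤|B| : card (B ∪ᶠ A) ≤ card B
  |B∪A|≤|B| = *-cancelˡ-≤ 4 (*-cancelʳ-≤ _ _ (2 ^ n) (begin
    4 * card (B ∪ᶠ A) * 2 ^ n         ≡⟨ cong (4 * card (B ∪ᶠ A) *_) (sym 4|C|≡N) ⟩
    4 * card (B ∪ᶠ A) * (4 * card C)  ≤⟨ CrossIU⇒4card*4card≤4^n (∪ᶠ-CrossIU BC AC) ⟩
    2 ^ n * 2 ^ n                     ≡⟨ cong (_* 2 ^ n) (sym 4|B|≡N) ⟩
    4 * card B * 2 ^ n                ∎))
    where open ≤-Reasoning

∃-≢₂ : ∀ {d} {i j : Fin d} → 3 ≤ d → i ≢ j → ∃[ k ] k ≢ i × k ≢ j
∃-≢₂ {i = i} (s≤s (s≤s (s≤s _))) i≢j =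
  punchIn i (punchIn j′ 0F) ,
  punchInᵢ≢i i _ ,
  λ k≡j → punchInᵢ≢i j′ 0F (punchIn-injective i _ _ (trans k≡j (sym (punchIn-punchOut i≢j))))
  where
  j′ = punchOut i≢j

quarter-sized-families-coincide : ∀ {d} → 3 ≤ d → (𝒜 : Fin d → Family n) →
  (∀ i j → i ≢ j → CrossIU (𝒜 i) (𝒜 j)) → (∀ i → 4 * card (𝒜 i) ≡ 2 ^ n) →
  ∀ i j → SameFamily (𝒜 i) (𝒜 j)
quarter-sized-families-coincide 3≤d 𝒜 cross quarter i j with i Fin.≟ j
... | yes refl = λ _ → refl
... | no i≢j =
  let k , k≢i , k≢j = ∃-≢₂ 3≤d i≢j
      ⊆ᶠ-via-k : ∀ {i j} → i ≢ k → j ≢ k → 𝒜 i ⊆ᶠ 𝒜 j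
      ⊆ᶠ-via-k i≢k j≢k = quarter-sized-⊆ᶠ (cross _ k i≢k) (cross _ k j≢k) (quarter _) (quarter k)
  in ⊆ᶠ-antisym (⊆ᶠ-via-k (≢-sym k≢i) (≢-sym k≢j)) (⊆ᶠ-via-k (≢-sym k≢j) (≢-sym k≢i))

+-≡-split : ∀ {a b c d} → a ≤ b → c ≤ d → a + c ≡ b + d → a ≡ b × c ≡ d
+-≡-split {a} a≤b c≤d a+c≡b+d with m≤n⇒m<n∨m≡n a≤b
... | inj₁ a<b = contradiction a+c≡b+d (<⇒≢ (+-mono-<-≤ a<b c≤d))
... | inj₂ refl = refl , +-cancelˡ-≡ a _ _ a+c≡b+d

sumFin-≤ : ∀ d {f : Fin d → ℕ} {c} → (∀ i → f i ≤ c) → sumFin d f ≤ d * c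
sumFin-≤ zero _ = z≤n
sumFin-≤ (suc d) f≤c = +-mono-≤ (f≤c 0F) (sumFin-≤ d (f≤c ∘ Fin.suc))

sumFin≡*⇒≡ : ∀ d {f : Fin d → ℕ} {c} → (∀ i → f i ≤ c) → sumFin d f ≡ d * c → ∀ i → f i ≡ c
sumFin≡*⇒≡ (suc d) f≤c Σf≡dc i with +-≡-split (f≤c 0F) (sumFin-≤ d (f≤c ∘ Fin.suc)) Σf≡dc | i
... | f₀≡c , _ | 0F = f₀≡c
... | _ , rest≡dc | Fin.suc j = sumFin≡*⇒≡ d (f≤c ∘ Fin.suc) rest≡dc j

*-sumFin : ∀ d r {f : Fin d → ℕ} {c} → (∀ i → r * f i ≡ c) → r * sumFin d f ≡ d * c
*-sumFin zero r _ = *-zeroʳ r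
*-sumFin (suc d) r {f} rf≡c = begin
  r * (f 0F + sumFin d (f ∘ Fin.suc))    ≡⟨ *-distribˡ-+ r _ _ ⟩
  r * f 0F + r * sumFin d (f ∘ Fin.suc)  ≡⟨ cong₂ _+_ (rf≡c 0F) (*-sumFin d r (rf≡c ∘ Fin.suc)) ⟩
  _ + d * _                               ∎
  where open ≡-Reasoning

antitone⇒suc≤1 : ∀ {k} {a : Fin (suc (suc k)) → ℕ} → (∀ i j → i <ᶠ j → a j ≤ a i) →
  ∀ i → a (Fin.suc i) ≤ a 1F
antitone⇒suc≤1 _ 0F = ≤-refl
antitone⇒suc≤1 antitone (Fin.suc i) = antitone 1F (Fin.suc (Fin.suc i)) (s<s z<s)

square-≤⇒≤ : ∀ {x y} → x * x ≤ y * y → x ≤ y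
square-≤⇒≤ x²≤y² = ≮⇒≥ λ y<x → <⇒≱ (*-mono-< y<x y<x) x²≤y²

-- The gap is (N ∸ x) * (K ∸ N).
square-gap : ∀ {x N K} → x < N → N < K → N * N + x * K < x * N + N * K
square-gap {x} x<N N<K with m≤n⇒∃[o]m+o≡n x<N | m≤n⇒∃[o]m+o≡n N<K
... | t , refl | u , refl = ≤-trans (m<m+n _ z<s) (≤-reflexive (gap x t u))
  where
  gap : ∀ x t u → let N = 1 + x + t in
    N * N + x * (1 + N + u) + (1 + t) * (1 + u) ≡ x * N + N * (1 + N + u)
  gap = solve-∀

-- x, y and w stand for 4|A₂|, 4|A₁| and 4(|A₂| + ⋯ + |A_d|).
scaled-sizes-bound : ∀ {k N x y w} .{{_ : NonZero N}} → 4 ≤ k → x ≤ y → y + x ≤ 4 * N →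
  x * y ≤ N * N → w ≤ k * x → y + w < suc k * N ⊎ (y ≡ N × x ≡ N × w ≡ k * x)
scaled-sizes-bound {k} {N} {zero} {y} {w} 4≤k _ y≤4N _ w≤k*0 = inj₁ (begin-strict
  y + w      ≤⟨ +-monoʳ-≤ y (≤-trans w≤k*0 (≤-reflexive (*-zeroʳ k))) ⟩
  y + 0      ≤⟨ y≤4N ⟩
  4 * N      <⟨ *-monoˡ-< N {4} {5} ≤-refl ⟩
  5 * N      ≤⟨ *-monoˡ-≤ N (s≤s 4≤k) ⟩
  suc k * N  ∎)
  where open ≤-Reasoning
scaled-sizes-bound {k} {N} {x@(suc _)} {y} {w} 4≤k x≤y y+x≤4N xy≤N² w≤kx with k * x ≤? N
... | yes kx≤N = inj₁ (begin-strict
  y + w        <⟨ m<m+n (y + w) z<s ⟩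
  y + w + x    ≡⟨ +-comm (y + w) x ⟩
  x + (y + w)  ≡⟨ sym (+-assoc x y w) ⟩
  x + y + w    ≤⟨ +-mono-≤ (subst (_≤ 4 * N) (+-comm y x) y+x≤4N) (≤-trans w≤kx kx≤N) ⟩
  4 * N + N    ≡⟨ +-comm (4 * N) N ⟩
  5 * N        ≤⟨ *-monoˡ-≤ N (s≤s 4≤k) ⟩
  suc k * N    ∎)
  where open ≤-Reasoning
... | no kx≰N with m≤n⇒m<n∨m≡n (square-≤⇒≤ {x} {N} (≤-trans (*-monoʳ-≤ x x≤y) xy≤N²))
...   | inj₁ x<N = inj₁ (*-cancelˡ-< x _ _ (begin-strict
  x * (y + w)          ≡⟨ *-distribˡ-+ x y w ⟩
  x * y + x * w        ≤⟨ +-mono-≤ xy≤N² (*-monoʳ-≤ x w≤kx) ⟩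
  N * N + x * (k * x)  <⟨ square-gap x<N (≰⇒> kx≰N) ⟩
  x * N + N * (k * x)  ≡⟨ regroup k x N ⟩
  x * (suc k * N)      ∎))
  where
  open ≤-Reasoning
  regroup : ∀ k x N → x * N + N * (k * x) ≡ x * ((1 + k) * N)
  regroup = solve-∀
...   | inj₂ refl with m≤n⇒m<n∨m≡n w≤kx
...     | inj₁ w<kx = inj₁ (+-mono-≤-< (*-cancelˡ-≤ x xy≤N²) w<kx)
...     | inj₂ w≡kx = inj₂ (≤-antisym (*-cancelˡ-≤ x xy≤N²) x≤y , refl , w≡kx)

sizes-bound : ∀ {k N v m s} .{{_ : NonZero N}} → 4 ≤ k → m ≤ v → v + m ≤ N →
  4 * m * (4 * v) ≤ N * N → s ≤ k * m →
  4 * (v + s) < suc k * N ⊎ (4 * v ≡ N × 4 * m ≡ N × s ≡ k * m)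
sizes-bound {k} {N} {v} {m} {s} 4≤k m≤v v+m≤N 4m*4v≤N² s≤km =
  Sum.map (subst (_< suc k * N) (sym (*-distribˡ-+ 4 v s)))
          (Σ.map₂ (Σ.map₂ λ 4s≡k*4m → *-cancelˡ-≡ s (k * m) 4 (trans 4s≡k*4m (sym (x∙yz≈y∙xz 4 k m)))))
          (scaled-sizes-bound 4≤k (*-monoʳ-≤ 4 m≤v) 4v+4m≤4N 4m*4v≤N²
                              (≤-trans (*-monoʳ-≤ 4 s≤km) (≤-reflexive (x∙yz≈y∙xz 4 k m))))
  where
  4v+4m≤4N : 4 * v + 4 * m ≤ 4 * N
  4v+4m≤4N = subst (_≤ 4 * N) (*-distribˡ-+ 4 v m) (*-monoʳ-≤ 4 v+m≤N)

corollary1 : (n d : ℕ) → 1 ≤ n → 5 ≤ d → (𝒜 : Fin d → Family n)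
    → (∀ i j → ¬ (i ≡ j) → CrossIU (𝒜 i) (𝒜 j))
    → (∀ (i j : Fin d) → i <ᶠ j → card (𝒜 j) ≤ card (𝒜 i))
    → (4 * sumFin d (λ i → card (𝒜 i)) ≤ d * 2 ^ n)
      × ((4 * sumFin d (λ i → card (𝒜 i)) < d * 2 ^ n)
         ⊎ (∀ i j → SameFamily (𝒜 i) (𝒜 j)))
corollary1 n (suc k) _ 5≤d@(s≤s 4≤k@(s≤s _)) 𝒜 cross sorted
  with sizes-bound {{m^n≢0 2 n}} 4≤k (sorted 0F 1F z<s) (CrossIU⇒card+card≤2^n (cross 0F 1F λ ()))
         (CrossIU⇒4card*4card≤4^n (cross 1F 0F λ ())) (sumFin-≤ k (antitone⇒suc≤1 sorted))
... | inj₁ lt = <⇒≤ lt , inj₁ lt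
... | inj₂ (4|A₀|≡N , 4|A₁|≡N , rest≡k*|A₁|) =
  ≤-reflexive (*-sumFin (suc k) 4 {λ i → card (𝒜 i)} quarter) ,
  inj₂ (quarter-sized-families-coincide (≤-trans (m≤m+n 3 2) 5≤d) 𝒜 cross quarter)
  where
  quarter : ∀ i → 4 * card (𝒜 i) ≡ 2 ^ n
  quarter 0F = 4|A₀|≡N
  quarter (Fin.suc i) =
    trans (cong (4 *_) (sumFin≡*⇒≡ k (antitone⇒suc≤1 sorted) rest≡k*|A₁| i)) 4|A₁|≡N
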